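{- Let $x,y,z,w\in\mathbb{Q}$. Then $x^4+y^4=z^4+w^4$ if and only if there exist $a,b\in\mathbb{Q}$, not both zero, such that $$\begin{cases} a x^2-b y^2=a z^2+b w^2,\\ b x^2+a y^2=-b z^2+a w^2.\end{cases}$$ -}

module Defs where

open import Data.Nat using (ℕ; zero; suc)
open import Data.Rational using (ℚ; 1ℚ; _*_)

infixr 8 _^_
_^_ : ℚ → ℕ → ℚ
x ^ zero = 1ℚ
x ^ suc n = x * (x ^ n)

{-# OPTIONS --safe #-}
module Submission where

-- For X = x², Y = y², Z = z², W = w² the system reads M (a , b) = 0 with
-- M = [[X − Z, −(Y + W)], [Y − W, X + Z]], and det M = X² + Y² − Z² − W².
-- So the theorem is the fact that a 2×2 homogeneous linear system over a
-- field has a nonzero solution exactly when its determinant vanishes.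

open import Defs
open import Data.Rational using (ℚ; 0ℚ; _+_; _-_; _*_; -_)
open import Data.Product using (_×_; ∃₂)
open import Relation.Nullary using (¬_)
open import Relation.Binary.PropositionalEquality using (_≡_)
open import Function.Bundles using (_⇔_)

open import Data.Nat using (zero; suc)
import Data.Nat as ℕ
open import Data.Product using (_,_; map₂)
open import Level using (0ℓ)
open import Data.Rational using (1ℚ; 1/_)
open import Data.Rational.Base using (≢-nonZero)
open import Data.Rational.Properties
  using (_≟_; +-*-commutativeRing; *-identityˡ; *-inverseˡ; *-assoc; *-zeroʳ; neg-injective)
open import Data.Rational.Solver using (module +-*-Solver)
open import Algebra.Bundles using (CommutativeRing)
open import Algebra.Properties.Group (CommutativeRing.+-group +-*-commutativeRing)
  using (x∙y⁻¹≈ε⇒x≈y; x≈y⇒x∙y⁻¹≈ε)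
open import Relation.Nullary using (yes; no; contradiction)
open import Relation.Nullary.Decidable using (_×-dec_)
open import Relation.Binary.PropositionalEquality
  using (_≢_; refl; sym; trans; cong; cong₂; module ≡-Reasoning)
open import Function.Bundles using (mk⇔; Equivalence)
open import Function.Construct.Identity using (⇔-id)
open import Function.Construct.Symmetry using (⇔-sym)
open import Function.Properties.Equivalence using (⇔-setoid)
open import Data.Product.Function.NonDependent.Propositional using (_×-⇔_)
import Relation.Binary.Reasoning.Setoid as SetoidReasoning

open +-*-Solver

^-distribˡ-+-* : ∀ x m n → x ^ (m ℕ.+ n) ≡ x ^ m * x ^ n
^-distribˡ-+-* x zero    n = sym (*-identityˡ (x ^ n))
^-distribˡ-+-* x (suc m) n = begin
  x * x ^ (m ℕ.+ n)     ≡⟨ cong (x *_) (^-distribˡ-+-* x m n) ⟩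
  x * (x ^ m * x ^ n)   ≡⟨ *-assoc x (x ^ m) (x ^ n) ⟨
  x * x ^ m * x ^ n     ∎
  where open ≡-Reasoning

difference≡⇒≡⇔≡ : ∀ {l r l′ r′ : ℚ} → l - r ≡ l′ - r′ → (l ≡ r) ⇔ (l′ ≡ r′)
difference≡⇒≡⇔≡ {l} {r} {l′} {r′} eq = mk⇔
  (λ l≡r → x∙y⁻¹≈ε⇒x≈y l′ r′ (trans (sym eq) (x≈y⇒x∙y⁻¹≈ε l≡r)))
  (λ l′≡r′ → x∙y⁻¹≈ε⇒x≈y l r (trans eq (x≈y⇒x∙y⁻¹≈ε l′≡r′)))

p≢0⇒p*q≡0⇒q≡0 : ∀ {p q} → p ≢ 0ℚ → p * q ≡ 0ℚ → q ≡ 0ℚ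
p≢0⇒p*q≡0⇒q≡0 {p} {q} p≢0 pq≡0 = begin
  q               ≡⟨ *-identityˡ q ⟨
  1ℚ * q          ≡⟨ cong (_* q) (*-inverseˡ p) ⟨
  1/ p * p * q    ≡⟨ *-assoc (1/ p) p q ⟩
  1/ p * (p * q)  ≡⟨ cong (1/ p *_) pq≡0 ⟩
  1/ p * 0ℚ       ≡⟨ *-zeroʳ (1/ p) ⟩
  0ℚ              ∎
  where
  open ≡-Reasoning
  instance _ = ≢-nonZero p≢0

annihilatedByNonzeroPair⇒≡0 : ∀ {a b d} → ¬ (a ≡ 0ℚ × b ≡ 0ℚ) →
                              a * d ≡ 0ℚ → b * d ≡ 0ℚ → d ≡ 0ℚ
annihilatedByNonzeroPair⇒≡0 {a} {b} ab≢0 ad≡0 bd≡0 with a ≟ 0ℚ | b ≟ 0ℚ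
... | no a≢0  | _       = p≢0⇒p*q≡0⇒q≡0 a≢0 ad≡0
... | yes _   | no b≢0  = p≢0⇒p*q≡0⇒q≡0 b≢0 bd≡0
... | yes a≡0 | yes b≡0 = contradiction (a≡0 , b≡0) ab≢0

∃₂-cong : ∀ {A B : Set} {P Q : A → B → Set} → (∀ {a b} → P a b ⇔ Q a b) → ∃₂ P ⇔ ∃₂ Q
∃₂-cong P⇔Q = mk⇔ (map₂ (map₂ (Equivalence.to P⇔Q))) (map₂ (map₂ (Equivalence.from P⇔Q)))

det₂ : ℚ → ℚ → ℚ → ℚ → ℚ
det₂ m₁₁ m₁₂ m₂₁ m₂₂ = m₁₁ * m₂₂ - m₁₂ * m₂₁

HasNontrivialKernel : ℚ → ℚ → ℚ → ℚ → Set
HasNontrivialKernel m₁₁ m₁₂ m₂₁ m₂₂ = ∃₂ λ a b → ¬ (a ≡ 0ℚ × b ≡ 0ℚ) ×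
  m₁₁ * a + m₁₂ * b ≡ 0ℚ × m₂₁ * a + m₂₂ * b ≡ 0ℚ

hasNontrivialKernel⇒det≡0 : ∀ m₁₁ m₁₂ m₂₁ m₂₂ →
  HasNontrivialKernel m₁₁ m₁₂ m₂₁ m₂₂ → det₂ m₁₁ m₁₂ m₂₁ m₂₂ ≡ 0ℚ
hasNontrivialKernel⇒det≡0 m₁₁ m₁₂ m₂₁ m₂₂ (a , b , ab≢0 , row₁≡0 , row₂≡0) =
  annihilatedByNonzeroPair⇒≡0 ab≢0 a*det≡0 b*det≡0
  where
  open ≡-Reasoning
  a*det≡0 : a * det₂ m₁₁ m₁₂ m₂₁ m₂₂ ≡ 0ℚ
  a*det≡0 = begin
    a * (m₁₁ * m₂₂ - m₁₂ * m₂₁)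
      ≡⟨ solve 6 (λ a b m₁₁ m₁₂ m₂₁ m₂₂ →
           a :* (m₁₁ :* m₂₂ :- m₁₂ :* m₂₁) :=
           m₂₂ :* (m₁₁ :* a :+ m₁₂ :* b) :- m₁₂ :* (m₂₁ :* a :+ m₂₂ :* b))
         refl a b m₁₁ m₁₂ m₂₁ m₂₂ ⟩
    m₂₂ * (m₁₁ * a + m₁₂ * b) - m₁₂ * (m₂₁ * a + m₂₂ * b)
      ≡⟨ cong₂ (λ r s → m₂₂ * r - m₁₂ * s) row₁≡0 row₂≡0 ⟩
    m₂₂ * 0ℚ - m₁₂ * 0ℚ
      ≡⟨ solve 2 (λ m₁₂ m₂₂ → m₂₂ :* con 0ℚ :- m₁₂ :* con 0ℚ := con 0ℚ) refl m₁₂ m₂₂ ⟩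
    0ℚ ∎
  b*det≡0 : b * det₂ m₁₁ m₁₂ m₂₁ m₂₂ ≡ 0ℚ
  b*det≡0 = begin
    b * (m₁₁ * m₂₂ - m₁₂ * m₂₁)
      ≡⟨ solve 6 (λ a b m₁₁ m₁₂ m₂₁ m₂₂ →
           b :* (m₁₁ :* m₂₂ :- m₁₂ :* m₂₁) :=
           m₁₁ :* (m₂₁ :* a :+ m₂₂ :* b) :- m₂₁ :* (m₁₁ :* a :+ m₁₂ :* b))
         refl a b m₁₁ m₁₂ m₂₁ m₂₂ ⟩
    m₁₁ * (m₂₁ * a + m₂₂ * b) - m₂₁ * (m₁₁ * a + m₁₂ * b)
      ≡⟨ cong₂ (λ r s → m₁₁ * r - m₂₁ * s) row₂≡0 row₁≡0 ⟩
    m₁₁ * 0ℚ - m₂₁ * 0ℚ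
      ≡⟨ solve 2 (λ m₁₁ m₂₁ → m₁₁ :* con 0ℚ :- m₂₁ :* con 0ℚ := con 0ℚ) refl m₁₁ m₂₁ ⟩
    0ℚ ∎

det≡0⇒hasNontrivialKernel : ∀ m₁₁ m₁₂ m₂₁ m₂₂ →
  det₂ m₁₁ m₁₂ m₂₁ m₂₂ ≡ 0ℚ → HasNontrivialKernel m₁₁ m₁₂ m₂₁ m₂₂
-- The rows (−m₁₂ , m₁₁) and (m₂₂ , −m₂₁) of the adjugate lie in the kernel
-- when det ≡ 0; one of them is nonzero unless M is the zero matrix.
det≡0⇒hasNontrivialKernel m₁₁ m₁₂ m₂₁ m₂₂ det≡0 with (m₁₂ ≟ 0ℚ) ×-dec (m₁₁ ≟ 0ℚ)
... | no row₁≢0 = - m₁₂ , m₁₁ , (λ (e , f) → row₁≢0 (neg-injective e , f)) ,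
  solve 2 (λ m₁₁ m₁₂ → m₁₁ :* (:- m₁₂) :+ m₁₂ :* m₁₁ := con 0ℚ) refl m₁₁ m₁₂ ,
  trans (solve 4 (λ m₁₁ m₁₂ m₂₁ m₂₂ →
           m₂₁ :* (:- m₁₂) :+ m₂₂ :* m₁₁ := m₁₁ :* m₂₂ :- m₁₂ :* m₂₁)
         refl m₁₁ m₁₂ m₂₁ m₂₂) det≡0
... | yes (refl , refl) with (m₂₂ ≟ 0ℚ) ×-dec (m₂₁ ≟ 0ℚ)
...   | no row₂≢0 = m₂₂ , - m₂₁ , (λ (e , f) → row₂≢0 (e , neg-injective f)) ,
  trans (solve 2 (λ m₂₁ m₂₂ →
           con 0ℚ :* m₂₂ :+ con 0ℚ :* (:- m₂₁) := con 0ℚ :* m₂₂ :- con 0ℚ :* m₂₁)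
         refl m₂₁ m₂₂) det≡0 ,
  solve 2 (λ m₂₁ m₂₂ → m₂₁ :* m₂₂ :+ m₂₂ :* (:- m₂₁) := con 0ℚ) refl m₂₁ m₂₂
...   | yes (refl , refl) = 1ℚ , 0ℚ , (λ ()) , refl , refl

hasNontrivialKernel⇔det≡0 : ∀ m₁₁ m₁₂ m₂₁ m₂₂ →
  HasNontrivialKernel m₁₁ m₁₂ m₂₁ m₂₂ ⇔ (det₂ m₁₁ m₁₂ m₂₁ m₂₂ ≡ 0ℚ)
hasNontrivialKernel⇔det≡0 m₁₁ m₁₂ m₂₁ m₂₂ =
  mk⇔ (hasNontrivialKernel⇒det≡0 m₁₁ m₁₂ m₂₁ m₂₂) (det≡0⇒hasNontrivialKernel m₁₁ m₁₂ m₂₁ m₂₂)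

x²+y²≡z²+w²⇔nonzeroSolution : (X Y Z W : ℚ) →
  (X * X + Y * Y ≡ Z * Z + W * W) ⇔
  ∃₂ (λ (a b : ℚ) → ¬ (a ≡ 0ℚ × b ≡ 0ℚ) ×
    (a * X - b * Y ≡ a * Z + b * W) × (b * X + a * Y ≡ (- b) * Z + a * W))
x²+y²≡z²+w²⇔nonzeroSolution X Y Z W = begin
  X * X + Y * Y ≡ Z * Z + W * W
    ≈⟨ difference≡⇒≡⇔≡ (solve 4 (λ X Y Z W →
         X :* X :+ Y :* Y :- (Z :* Z :+ W :* W) :=
         (X :- Z) :* (X :+ Z) :- (:- (Y :+ W)) :* (Y :- W) :- con 0ℚ)
       refl X Y Z W) ⟩
  det₂ (X - Z) (- (Y + W)) (Y - W) (X + Z) ≡ 0ℚ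
    ≈⟨ ⇔-sym (hasNontrivialKernel⇔det≡0 (X - Z) (- (Y + W)) (Y - W) (X + Z)) ⟩
  HasNontrivialKernel (X - Z) (- (Y + W)) (Y - W) (X + Z)
    ≈⟨ ∃₂-cong (⇔-id _ ×-⇔ (row₁⇔ ×-⇔ row₂⇔)) ⟩
  ∃₂ (λ a b → ¬ (a ≡ 0ℚ × b ≡ 0ℚ) ×
    (a * X - b * Y ≡ a * Z + b * W) × (b * X + a * Y ≡ (- b) * Z + a * W)) ∎
  where
  open SetoidReasoning (⇔-setoid 0ℓ)
  row₁⇔ : ∀ {a b} → ((X - Z) * a + (- (Y + W)) * b ≡ 0ℚ) ⇔ (a * X - b * Y ≡ a * Z + b * W)
  row₁⇔ {a} {b} = difference≡⇒≡⇔≡ (solve 6 (λ a b X Y Z W →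
    (X :- Z) :* a :+ (:- (Y :+ W)) :* b :- con 0ℚ := a :* X :- b :* Y :- (a :* Z :+ b :* W))
    refl a b X Y Z W)
  row₂⇔ : ∀ {a b} → ((Y - W) * a + (X + Z) * b ≡ 0ℚ) ⇔ (b * X + a * Y ≡ (- b) * Z + a * W)
  row₂⇔ {a} {b} = difference≡⇒≡⇔≡ (solve 6 (λ a b X Y Z W →
    (Y :- W) :* a :+ (X :+ Z) :* b :- con 0ℚ := b :* X :+ a :* Y :- ((:- b) :* Z :+ a :* W))
    refl a b X Y Z W)

lemma2p1 : (x y z w : ℚ) →
    ((x ^ 4) + (y ^ 4) ≡ (z ^ 4) + (w ^ 4)) ⇔
    ∃₂ (λ (a b : ℚ) → ¬ (a ≡ 0ℚ × b ≡ 0ℚ) ×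
      ((a * (x ^ 2)) - (b * (y ^ 2)) ≡ (a * (z ^ 2)) + (b * (w ^ 2))) ×
      ((b * (x ^ 2)) + (a * (y ^ 2)) ≡ ((- b) * (z ^ 2)) + (a * (w ^ 2))))
lemma2p1 x y z w = begin
  x ^ 4 + y ^ 4 ≡ z ^ 4 + w ^ 4
    ≡⟨ cong₂ _≡_ (cong₂ _+_ (x⁴≡x²x² x) (x⁴≡x²x² y)) (cong₂ _+_ (x⁴≡x²x² z) (x⁴≡x²x² w)) ⟩
  x ^ 2 * x ^ 2 + y ^ 2 * y ^ 2 ≡ z ^ 2 * z ^ 2 + w ^ 2 * w ^ 2
    ≈⟨ x²+y²≡z²+w²⇔nonzeroSolution (x ^ 2) (y ^ 2) (z ^ 2) (w ^ 2) ⟩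
  _ ∎
  where
  open SetoidReasoning (⇔-setoid 0ℓ)
  x⁴≡x²x² : ∀ t → t ^ 4 ≡ t ^ 2 * t ^ 2
  x⁴≡x²x² t = ^-distribˡ-+-* t 2 2
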